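{- Let T1 be the Hilbert system described in the context, and let T1$^*$ be the system obtained from T1 by replacing the axiom scheme (S5) $\lozenge A\rightarrow\square\lozenge A$ with the scheme $(*)$ $\sim x = y\rightarrow \square\sim x=y$. Then T1 and T1$^*$ are equivalent, i.e. they have the same theorems.
   Context: The language $L^\omega$ has countably many variables, countably many $n$-ary predicate symbols including a distinguished binary predicate $=$, connectives $\&,\sim$, the quantifier $\exists$ (with $\rightarrow,\leftrightarrow,\vee,\forall$ defined as usual), and an intensional abstraction operator. Terms and formulas are defined simultaneously: variables are terms; if $t_1,\dots,t_n$ are terms and $F$ is $n$-ary then $F(t_1,\dots,t_n)$ is a formula; if $A,B$ are formulas and $v$ a variable then $(A\&B)$, $\sim A$, $\exists v. A$ are formulas; if $A$ is a formula and $v_1,\dots,v_m$ ($m\ge 0$) are distinct variables then $[A]_{v_1\dots v_m}$ is a term (variables $v_i$ are bound in it); write $[A]$ when $m=0$. Define $\square A :\equiv [A] = [[A]=[A]]$ and $\lozenge A :\equiv \sim\square\sim A$. The system T1 has the axioms: all tautologies; (Ins) $\forall v. A(v)\rightarrow A(t)$ for $t$ free for $v$ in $A$; (QImp) $\forall v.(A\rightarrow B)\rightarrow(A\rightarrow\forall v. B)$ for $v$ not free in $A$; (Id) $v=v$; (L) $v=w\rightarrow(A(v,v)\leftrightarrow A(v,w))$, where $A(v,w)$ results from $A(v,v)$ by replacing some free occurrences of $v$ by $w$, $w$ being free for $v$ at those positions; $\sim [A]_{\bar x}=[B]_{\bar y}$ whenever $\bar x,\bar y$ have different lengths; $[A]_{\bar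 x}=[A']_{\bar x'}$ whenever these are alphabetic variants ($\alpha$-equivalence); (B) $[A]_{\bar x}=[B]_{\bar x}\leftrightarrow\square\forall\bar x.(A\leftrightarrow B)$; (T) $\square A\rightarrow A$; (K) $\square(A\rightarrow B)\rightarrow(\square A\rightarrow\square B)$; (S5) $\lozenge A\rightarrow\square\lozenge A$. Rules: (MP) from $A$ and $A\rightarrow B$ infer $B$; (N) from $A$ infer $\square A$; (Gen) from $A$ infer $\forall v. A$. -}

module Defs where

open import Data.Nat using (ℕ; _≡ᵇ_)
open import Data.Bool using (Bool; true; false; if_then_else_; _∧_; not)
open import Data.List using (List; []; _∷_; length; zip; _++_)
open import Data.Bool.ListAction using (any)
open import Data.List.Relation.Unary.Unique.Propositional using (Unique)
open import Data.List.Relation.Unary.AllPairs using ([])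
open import Data.List.Membership.Propositional using (_∈_; _∉_)
open import Data.Vec using (Vec; []; _∷_)
open import Data.Product using (_×_; _,_)
open import Data.Sum using (_⊎_)
open import Data.Unit using (⊤)
open import Relation.Nullary using (¬_)
open import Relation.Binary.PropositionalEquality using (_≡_; _≢_)

-- Syntax of L^ω
-- Variables are natural numbers.  'pred n k ts' is the k-th n-ary
-- predicate symbol (other than '=') applied to ts; '_≐_' is the
-- distinguished binary predicate '='.  'abs vs p A' is [A]_{vs}, where
-- p witnesses that the variables vs are pairwise distinct.

Var : Set
Var = ℕ

infix  7 _≐_
infixr 6 _&_
infix  8 ~_

mutual
  data Term : Set where
    var : Var → Term
    abs : (vs : List Var) → Unique vs → Formula → Term

  data Formula : Set where
    pred : (n k : ℕ) → Vec Term n → Formula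
    _≐_  : Term → Term → Formula
    _&_  : Formula → Formula → Formula
    ~_   : Formula → Formula
    ex   : Var → Formula → Formula

infixr 4 _⇒_
infix  3 _⇔_

_⇒_ : Formula → Formula → Formula
A ⇒ B = ~ (A & ~ B)

_∨_ : Formula → Formula → Formula
A ∨ B = ~ (~ A & ~ B)

_⇔_ : Formula → Formula → Formula
A ⇔ B = (A ⇒ B) & (B ⇒ A)

all : Var → Formula → Formula
all v A = ~ ex v (~ A)

allL : List Var → Formula → Formula
allL []       A = A
allL (x ∷ xs) A = all x (allL xs A)

⟦_⟧ : Formula → Term
⟦ A ⟧ = abs [] [] A

□ : Formula → Formula
□ A = ⟦ A ⟧ ≐ ⟦ ⟦ A ⟧ ≐ ⟦ A ⟧ ⟧

◇ : Formula → Formula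
◇ A = ~ □ (~ A)

mutual
  data FreeT (v : Var) : Term → Set where
    f-var : FreeT v (var v)
    f-abs : ∀ {vs p A} → v ∉ vs → FreeF v A → FreeT v (abs vs p A)

  data FreeF (v : Var) : Formula → Set where
    f-pred : ∀ {n k ts} → FreeVs v {n} ts → FreeF v (pred n k ts)
    f-eqˡ  : ∀ {s t} → FreeT v s → FreeF v (s ≐ t)
    f-eqʳ  : ∀ {s t} → FreeT v t → FreeF v (s ≐ t)
    f-andˡ : ∀ {A B} → FreeF v A → FreeF v (A & B)
    f-andʳ : ∀ {A B} → FreeF v B → FreeF v (A & B)
    f-neg  : ∀ {A} → FreeF v A → FreeF v (~ A)
    f-ex   : ∀ {u A} → u ≢ v → FreeF v A → FreeF v (ex u A)

  data FreeVs (v : Var) : ∀ {n} → Vec Term n → Set where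
    here  : ∀ {n t} {ts : Vec Term n} → FreeT v t → FreeVs v (t ∷ ts)
    there : ∀ {n t} {ts : Vec Term n} → FreeVs v ts → FreeVs v (t ∷ ts)

-- Substitution of a term t for the free occurrences of v
-- (plain replacement; used only together with the side condition
-- "t is free for v").

mutual
  substT : Var → Term → Term → Term
  substT v t (var u)      = if u ≡ᵇ v then t else var u
  substT v t (abs vs p A) =
    if any (_≡ᵇ v) vs then abs vs p A else abs vs p (substF v t A)

  substF : Var → Term → Formula → Formula
  substF v t (pred n k ts) = pred n k (substVs v t ts)
  substF v t (a ≐ b)       = substT v t a ≐ substT v t b
  substF v t (A & B)       = substF v t A & substF v t B
  substF v t (~ A)         = ~ substF v t A
  substF v t (ex u A)      = if u ≡ᵇ v then ex u A else ex u (substF v t A)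

  substVs : ∀ {n} → Var → Term → Vec Term n → Vec Term n
  substVs v t []       = []
  substVs v t (s ∷ ss) = substT v t s ∷ substVs v t ss

mutual
  FreeForT : Term → Var → Term → Set
  FreeForT t v (var u)      = ⊤
  FreeForT t v (abs vs p A) =
    ¬ FreeT v (abs vs p A) ⊎ ((∀ w → w ∈ vs → ¬ FreeT w t) × FreeForF t v A)

  FreeForF : Term → Var → Formula → Set
  FreeForF t v (pred n k ts) = FreeForVs t v ts
  FreeForF t v (a ≐ b)       = FreeForT t v a × FreeForT t v b
  FreeForF t v (A & B)       = FreeForF t v A × FreeForF t v B
  FreeForF t v (~ A)         = FreeForF t v A
  FreeForF t v (ex u A)      = ¬ FreeF v (ex u A) ⊎ (¬ FreeT u t × FreeForF t v A)

  FreeForVs : ∀ {n} → Term → Var → Vec Term n → Set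
  FreeForVs t v []       = ⊤
  FreeForVs t v (s ∷ ss) = FreeForT t v s × FreeForVs t v ss

-- ReplF v w A A' : A' results from A by replacing some free occurrences
-- of v by w, w being free for v at those positions.

mutual
  data ReplT (v w : Var) : Term → Term → Set where
    r-var      : ∀ u → ReplT v w (var u) (var u)
    r-swap     : ReplT v w (var v) (var w)
    r-abs-keep : ∀ vs p A → ReplT v w (abs vs p A) (abs vs p A)
    r-abs      : ∀ {vs p A A'} → v ∉ vs → w ∉ vs → ReplF v w A A' →
                 ReplT v w (abs vs p A) (abs vs p A')

  data ReplF (v w : Var) : Formula → Formula → Set where
    r-pred    : ∀ {n k ts ts'} → ReplVs v w {n} ts ts' →
                ReplF v w (pred n k ts) (pred n k ts')
    r-eq      : ∀ {a a' b b'} → ReplT v w a a' → ReplT v w b b' →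
                ReplF v w (a ≐ b) (a' ≐ b')
    r-and     : ∀ {A A' B B'} → ReplF v w A A' → ReplF v w B B' →
                ReplF v w (A & B) (A' & B')
    r-neg     : ∀ {A A'} → ReplF v w A A' → ReplF v w (~ A) (~ A')
    r-ex-keep : ∀ u A → ReplF v w (ex u A) (ex u A)
    r-ex      : ∀ {u A A'} → u ≢ v → u ≢ w → ReplF v w A A' →
                ReplF v w (ex u A) (ex u A')

  data ReplVs (v w : Var) : ∀ {n} → Vec Term n → Vec Term n → Set where
    []  : ReplVs v w [] []
    _∷_ : ∀ {n t t'} {ts ts' : Vec Term n} → ReplT v w t t' →
          ReplVs v w ts ts' → ReplVs v w (t ∷ ts) (t' ∷ ts')

-- Alphabetic variants (α-equivalence), via a context of corresponding
-- bound variables (most recent binder first).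

Ctx : Set
Ctx = List (Var × Var)

data Corr : Ctx → Var → Var → Set where
  c-nil   : ∀ x → Corr [] x x
  c-here  : ∀ {Γ x y} → Corr ((x , y) ∷ Γ) x y
  c-there : ∀ {Γ a b x y} → x ≢ a → y ≢ b → Corr Γ x y → Corr ((a , b) ∷ Γ) x y

mutual
  data AlphaT : Ctx → Term → Term → Set where
    a-var : ∀ {Γ x y} → Corr Γ x y → AlphaT Γ (var x) (var y)
    a-abs : ∀ {Γ xs p A ys q B} → length xs ≡ length ys →
            AlphaF (zip xs ys ++ Γ) A B → AlphaT Γ (abs xs p A) (abs ys q B)

  data AlphaF : Ctx → Formula → Formula → Set where
    a-pred : ∀ {Γ n k ts ts'} → AlphaVs Γ {n} ts ts' →
             AlphaF Γ (pred n k ts) (pred n k ts')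
    a-eq   : ∀ {Γ a a' b b'} → AlphaT Γ a a' → AlphaT Γ b b' →
             AlphaF Γ (a ≐ b) (a' ≐ b')
    a-and  : ∀ {Γ A A' B B'} → AlphaF Γ A A' → AlphaF Γ B B' →
             AlphaF Γ (A & B) (A' & B')
    a-neg  : ∀ {Γ A A'} → AlphaF Γ A A' → AlphaF Γ (~ A) (~ A')
    a-ex   : ∀ {Γ u u' A A'} → AlphaF ((u , u') ∷ Γ) A A' →
             AlphaF Γ (ex u A) (ex u' A')

  data AlphaVs : Ctx → ∀ {n} → Vec Term n → Vec Term n → Set where
    []  : ∀ {Γ} → AlphaVs Γ [] []
    _∷_ : ∀ {Γ n t t'} {ts ts' : Vec Term n} → AlphaT Γ t t' →
          AlphaVs Γ ts ts' → AlphaVs Γ (t ∷ ts) (t' ∷ ts')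

-- Tautologies: true under every truth-value assignment to the prime
-- (atomic and existential) formulas, with & and ~ read truth-functionally.

eval : (Formula → Bool) → Formula → Bool
eval val (pred n k ts) = val (pred n k ts)
eval val (a ≐ b)       = val (a ≐ b)
eval val (A & B)       = eval val A ∧ eval val B
eval val (~ A)         = not (eval val A)
eval val (ex u A)      = val (ex u A)

Tautology : Formula → Set
Tautology A = ∀ (val : Formula → Bool) → eval val A ≡ true

data System : Set where
  T1 T1* : System

data Axiom : System → Formula → Set where
  ax-taut  : ∀ {s A} → Tautology A → Axiom s A
  ax-ins   : ∀ {s v t A} → FreeForF t v A → Axiom s (all v A ⇒ substF v t A)
  ax-qimp  : ∀ {s v A B} → ¬ FreeF v A →
             Axiom s (all v (A ⇒ B) ⇒ (A ⇒ all v B))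
  ax-id    : ∀ {s v} → Axiom s (var v ≐ var v)
  ax-L     : ∀ {s v w A A'} → ReplF v w A A' →
             Axiom s (var v ≐ var w ⇒ (A ⇔ A'))
  ax-len   : ∀ {s xs p A ys q B} → length xs ≢ length ys →
             Axiom s (~ (abs xs p A ≐ abs ys q B))
  ax-alpha : ∀ {s xs p A ys q B} → AlphaT [] (abs xs p A) (abs ys q B) →
             Axiom s (abs xs p A ≐ abs ys q B)
  ax-B     : ∀ {s xs p A B} →
             Axiom s ((abs xs p A ≐ abs xs p B) ⇔ □ (allL xs (A ⇔ B)))
  ax-T     : ∀ {s A} → Axiom s (□ A ⇒ A)
  ax-K     : ∀ {s A B} → Axiom s (□ (A ⇒ B) ⇒ (□ A ⇒ □ B))
  ax-S5    : ∀ {A} → Axiom T1 (◇ A ⇒ □ (◇ A))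
  ax-star  : ∀ {x y} → Axiom T1* (~ (var x ≐ var y) ⇒ □ (~ (var x ≐ var y)))

data _⊢_ (s : System) : Formula → Set where
  ax  : ∀ {A} → Axiom s A → s ⊢ A
  mp  : ∀ {A B} → s ⊢ A → s ⊢ (A ⇒ B) → s ⊢ B
  nec : ∀ {A} → s ⊢ A → s ⊢ □ A
  gen : ∀ {A} v → s ⊢ A → s ⊢ all v A

-- Both systems share every rule and every axiom except (S5) and (*), so it
-- suffices to derive each of these in the other system.  In T1, (L) and
-- necessitation of (Id) give x = y → □ x = y, and in any S5 system a formula
-- that implies its own necessity has a necessary negation whenever it fails
-- (via the Brouwer law ◇□A → A).  In T1*, ◇A is by definition the inequation
-- ~ [~A] = [[~A] = [~A]], so (S5) is the instance of (*) at x := [~A],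
-- y := [[~A] = [~A]], reached by two instantiations of the variables.
module Submission where

open import Defs
open import Data.Product using (_×_; _,_)
open import Data.Sum using (inj₂)
open import Data.Bool using (true; false)
open import Data.Unit using (tt)
open import Relation.Binary.PropositionalEquality using (refl)

private
  variable
    s s′ : System
    A B C : Formula
    t : Term
    v w : Var

contraposition-taut : ∀ A B → Tautology ((A ⇒ B) ⇒ (~ B ⇒ ~ A))
contraposition-taut A B val with eval val A | eval val B
... | true  | true  = refl
... | true  | false = refl
... | false | true  = refl
... | false | false = refl

contraposition-~ˡ-taut : ∀ A B → Tautology ((~ A ⇒ B) ⇒ (~ B ⇒ A))
contraposition-~ˡ-taut A B val with eval val A | eval val B
... | true  | true  = refl
... | true  | false = refl
... | false | true  = refl
... | false | false = refl

double-negation-intro-taut : ∀ A → Tautology (A ⇒ ~ ~ A)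
double-negation-intro-taut A val with eval val A
... | true  = refl
... | false = refl

syllogism-taut : ∀ A B C → Tautology ((A ⇒ B) ⇒ ((B ⇒ C) ⇒ (A ⇒ C)))
syllogism-taut A B C val with eval val A | eval val B | eval val C
... | true  | true  | true  = refl
... | true  | true  | false = refl
... | true  | false | true  = refl
... | true  | false | false = refl
... | false | true  | true  = refl
... | false | true  | false = refl
... | false | false | true  = refl
... | false | false | false = refl

⇔-transport-taut : ∀ A B C → Tautology ((C ⇒ (A ⇔ B)) ⇒ (A ⇒ (C ⇒ B)))
⇔-transport-taut A B C val with eval val A | eval val B | eval val C
... | true  | true  | true  = refl
... | true  | true  | false = refl
... | true  | false | true  = refl
... | true  | false | false = refl
... | false | true  | true  = refl
... | false | true  | false = refl
... | false | false | true  = refl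
... | false | false | false = refl

by-taut : s ⊢ A → Tautology (A ⇒ B) → s ⊢ B
by-taut p taut = mp p (ax (ax-taut taut))

by-taut₂ : s ⊢ A → s ⊢ B → Tautology (A ⇒ (B ⇒ C)) → s ⊢ C
by-taut₂ p q taut = mp q (by-taut p taut)

contraposition : s ⊢ (A ⇒ B) → s ⊢ (~ B ⇒ ~ A)
contraposition {A = A} {B = B} p = by-taut p (contraposition-taut A B)

contraposition-~ˡ : s ⊢ (~ A ⇒ B) → s ⊢ (~ B ⇒ A)
contraposition-~ˡ {A = A} {B = B} p = by-taut p (contraposition-~ˡ-taut A B)

⇒-trans : s ⊢ (A ⇒ B) → s ⊢ (B ⇒ C) → s ⊢ (A ⇒ C)
⇒-trans {A = A} {B = B} {C = C} p q = by-taut₂ p q (syllogism-taut A B C)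

instantiate : ∀ v t → s ⊢ A → FreeForF t v A → s ⊢ substF v t A
instantiate v t p free = mp (gen v p) (ax (ax-ins free))

□-mono : s ⊢ (A ⇒ B) → s ⊢ (□ A ⇒ □ B)
□-mono p = mp (nec p) (ax ax-K)

◇-mono : s ⊢ (A ⇒ B) → s ⊢ (◇ A ⇒ ◇ B)
◇-mono p = contraposition (□-mono (contraposition p))

⇒◇ : s ⊢ (A ⇒ ◇ A)
⇒◇ {A = A} = ⇒-trans (ax (ax-taut (double-negation-intro-taut A)))
                     (contraposition (ax ax-T))

◇~⇒~□ : s ⊢ (◇ (~ A) ⇒ ~ □ A)
◇~⇒~□ {A = A} = contraposition (□-mono (ax (ax-taut (double-negation-intro-taut A))))

module S5 (s5 : ∀ {A} → s ⊢ (◇ A ⇒ □ (◇ A))) where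

  ⇒□◇ : s ⊢ (A ⇒ □ (◇ A))
  ⇒□◇ = ⇒-trans ⇒◇ s5

  ◇□⇒ : s ⊢ (◇ (□ A) ⇒ A)
  ◇□⇒ = contraposition-~ˡ (⇒-trans ⇒□◇ (□-mono ◇~⇒~□))

  ~-□-stable : s ⊢ (A ⇒ □ A) → s ⊢ (~ A ⇒ □ (~ A))
  ~-□-stable p = contraposition-~ˡ (⇒-trans (◇-mono p) ◇□⇒)

⟦⟧-repl : ReplF v w A B → ReplT v w ⟦ A ⟧ ⟦ B ⟧
⟦⟧-repl = r-abs (λ ()) (λ ())

□-repl : ReplF v w A B → ReplF v w (□ A) (□ B)
□-repl r = r-eq (⟦⟧-repl r) (⟦⟧-repl (r-eq (⟦⟧-repl r) (⟦⟧-repl r)))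

≐⇒□≐ : ∀ x y → s ⊢ (var x ≐ var y ⇒ □ (var x ≐ var y))
≐⇒□≐ x y = by-taut₂ (ax (ax-L (□-repl (r-eq (r-var x) r-swap)))) (nec (ax ax-id))
                    (⇔-transport-taut (□ (var x ≐ var x)) (□ (var x ≐ var y)) (var x ≐ var y))

≉⇒□≉ : Term → Term → Formula
≉⇒□≉ a b = ~ (a ≐ b) ⇒ □ (~ (a ≐ b))

star-in-T1 : ∀ x y → T1 ⊢ ≉⇒□≉ (var x) (var y)
star-in-T1 x y = S5.~-□-stable (ax ax-S5) (≐⇒□≐ x y)

⟦⟧-free-for : FreeForF t v A → FreeForT t v ⟦ A ⟧
⟦⟧-free-for free = inj₂ ((λ _ ()) , free)

□-free-for : FreeForF t v A → FreeForF t v (□ A)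
□-free-for free = ⟦⟧-free-for free , ⟦⟧-free-for (⟦⟧-free-for free , ⟦⟧-free-for free)

≉⇒□≉-free-for : ∀ {a b} → FreeForT t v a → FreeForT t v b → FreeForF t v (≉⇒□≉ a b)
≉⇒□≉-free-for fa fb = (fa , fb) , □-free-for (fa , fb)

s5-in-T1* : ∀ A → T1* ⊢ (◇ A ⇒ □ (◇ A))
s5-in-T1* A = instantiate 0 ⟦ ~ A ⟧ y≔⟦x≐x⟧ (≉⇒□≉-free-for tt (⟦⟧-free-for (tt , tt)))
  where
  y≔⟦x≐x⟧ : T1* ⊢ ≉⇒□≉ (var 0) ⟦ var 0 ≐ var 0 ⟧
  y≔⟦x≐x⟧ = instantiate 1 ⟦ var 0 ≐ var 0 ⟧ (ax (ax-star {x = 0} {y = 1})) (≉⇒□≉-free-for tt tt)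

simulate : (∀ {A} → Axiom s A → s′ ⊢ A) → s ⊢ A → s′ ⊢ A
simulate axioms (ax a)    = axioms a
simulate axioms (mp p q)  = mp (simulate axioms p) (simulate axioms q)
simulate axioms (nec p)   = nec (simulate axioms p)
simulate axioms (gen v p) = gen v (simulate axioms p)

T1-axiom-in-T1* : Axiom T1 A → T1* ⊢ A
T1-axiom-in-T1* (ax-taut taut)  = ax (ax-taut taut)
T1-axiom-in-T1* (ax-ins free)   = ax (ax-ins free)
T1-axiom-in-T1* (ax-qimp fresh) = ax (ax-qimp fresh)
T1-axiom-in-T1* ax-id           = ax ax-id
T1-axiom-in-T1* (ax-L r)        = ax (ax-L r)
T1-axiom-in-T1* (ax-len ne)     = ax (ax-len ne)
T1-axiom-in-T1* (ax-alpha α)    = ax (ax-alpha α)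
T1-axiom-in-T1* ax-B            = ax ax-B
T1-axiom-in-T1* ax-T            = ax ax-T
T1-axiom-in-T1* ax-K            = ax ax-K
T1-axiom-in-T1* (ax-S5 {A})     = s5-in-T1* A

T1*-axiom-in-T1 : Axiom T1* A → T1 ⊢ A
T1*-axiom-in-T1 (ax-taut taut)    = ax (ax-taut taut)
T1*-axiom-in-T1 (ax-ins free)     = ax (ax-ins free)
T1*-axiom-in-T1 (ax-qimp fresh)   = ax (ax-qimp fresh)
T1*-axiom-in-T1 ax-id             = ax ax-id
T1*-axiom-in-T1 (ax-L r)          = ax (ax-L r)
T1*-axiom-in-T1 (ax-len ne)       = ax (ax-len ne)
T1*-axiom-in-T1 (ax-alpha α)      = ax (ax-alpha α)
T1*-axiom-in-T1 ax-B              = ax ax-B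
T1*-axiom-in-T1 ax-T              = ax ax-T
T1*-axiom-in-T1 ax-K              = ax ax-K
T1*-axiom-in-T1 (ax-star {x} {y}) = star-in-T1 x y

lemma1p21 : ∀ (A : Formula) → (T1 ⊢ A → T1* ⊢ A) × (T1* ⊢ A → T1 ⊢ A)
lemma1p21 A = simulate T1-axiom-in-T1* , simulate T1*-axiom-in-T1
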